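{- Let $\chi^{SHG}$ be the basic invariant of the Hopf monoid $SHG$ of simple hypergraphs and $\chi$ the basic invariant of the Hopf monoid $HG$ of hypergraphs. Then for every finite set $I$ and every simple hypergraph $H$ over $I$, $\chi^{SHG}_I(H)=\chi_I(H)$ (viewing $H$ as a hypergraph).
   Context: A hypergraph over a finite set $I$ is a finite multiset of subsets of $I$ (edges); it is simple if no edge is repeated. For $I=S\sqcup T$: in $HG$, the product is disjoint union and the coproduct is $H\mapsto H|_S\otimes H/_S$ with $H|_S=\{e\in H: e\subseteq S\}$, $H/_S=\{e\cap T: e\in H,\ e\not\subseteq S\}$ (as multisets). In $SHG$, the product is union and the coproduct is $H\mapsto H|_S\otimes H/_S$ with $H|_S=\{e\in H: e\subseteq S\}$ and $H/_S=\{e\cap T: e\in H,\ e\not\subseteq S\}\cup\{\emptyset\}$ taken without repetition. In a Hopf monoid $M$, an element of $M[I]$ is discrete if it is a product of elements over singletons; here a (simple) hypergraph is discrete iff all its edges have cardinality at most $1$. For a decomposition $(S_1,\dots,S_n)$ of $I$ (pairwise disjoint possibly empty subsets with union $I$), $\Delta_{S_1,\dots,S_n}$ is the iterated coproduct. The basic invariant is $\chi^M_I(x)(n)=\sum_{(S_1,\dots,S_n)}\zeta_{S_1}\otimes\cdots\otimes\zeta_{S_n}(\Delta_{S_1,\dots,S_n}(x))$, summed over decompositions of $I$ of length $n$, where $\zeta$ is $1$ on discrete elements and $0$ on other basis elements; it is a polynomial in $n$. -}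

module Defs where

open import Data.Nat using (ℕ; zero; suc; _≤?_)
open import Data.Bool using (Bool; true; false; if_then_else_)
open import Data.Fin using (Fin) renaming (_≟_ to _≟ᶠ_)
open import Data.Fin.Subset using (Subset; inside; outside; _∩_; ∁; ∣_∣; ⊥)
open import Data.Fin.Subset.Properties using (_⊆?_)
open import Data.List using (List; []; _∷_; filter; map; deduplicate; concatMap; allFin)
open import Data.Nat.ListAction using (sum; product)
open import Data.List.Relation.Unary.All using (All)
open import Data.Vec using (Vec; []; _∷_; lookup; tabulate; toList)
import Data.Vec.Properties as VecP
import Data.Bool.Properties as BoolP
open import Relation.Nullary using (¬?)
open import Relation.Nullary.Decidable using (⌊_⌋)
open import Relation.Binary.Definitions using (DecidableEquality)

-- The ground set I is modelled as Fin k; subsets of I are 'Subset k'.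
-- A (multiset) hypergraph over I is a list of edges (order irrelevant;
-- multiplicity given by repetition). A simple hypergraph is such a list
-- without repetitions ('Unique', stated in the theorem).
Hypergraph : ℕ → Set
Hypergraph k = List (Subset k)

_≟ˢ_ : ∀ {k} → DecidableEquality (Subset k)
_≟ˢ_ = VecP.≡-dec BoolP._≟_

restrictHG : ∀ {k} → Subset k → Hypergraph k → Hypergraph k
restrictHG S H = filter (_⊆? S) H

contractHG : ∀ {k} → Subset k → Hypergraph k → Hypergraph k
contractHG S H = map (λ e → e ∩ ∁ S) (filter (λ e → ¬? (e ⊆? S)) H)

restrictSHG : ∀ {k} → Subset k → Hypergraph k → Hypergraph k
restrictSHG S H = filter (_⊆? S) H

contractSHG : ∀ {k} → Subset k → Hypergraph k → Hypergraph k
contractSHG S H =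
  deduplicate _≟ˢ_ (⊥ ∷ map (λ e → e ∩ ∁ S) (filter (λ e → ¬? (e ⊆? S)) H))

-- Iterated coproduct Δ_{S₁,…,Sₙ}(H) = H|_{S₁} ⊗ Δ_{S₂,…,Sₙ}(H/_{S₁}),
-- returned as the list of its n tensor factors.

ΔHG : ∀ {k} → List (Subset k) → Hypergraph k → List (Hypergraph k)
ΔHG []       H = []
ΔHG (S ∷ Ss) H = restrictHG S H ∷ ΔHG Ss (contractHG S H)

ΔSHG : ∀ {k} → List (Subset k) → Hypergraph k → List (Hypergraph k)
ΔSHG []       H = []
ΔSHG (S ∷ Ss) H = restrictSHG S H ∷ ΔSHG Ss (contractSHG S H)

ζ : ∀ {k} → Hypergraph k → ℕ
ζ [] = 1
ζ (e ∷ H) = if ⌊ ∣ e ∣ ≤? 1 ⌋ then ζ H else 0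

-- Decompositions (S₁,…,Sₙ) of I = Fin k (pairwise disjoint, possibly
-- empty, union I) correspond bijectively to maps f : Fin k → Fin n
-- (here vectors Vec (Fin n) k), with S_i = f⁻¹(i).

allVecs : (n k : ℕ) → List (Vec (Fin n) k)
allVecs n zero    = [] ∷ []
allVecs n (suc k) = concatMap (λ i → map (i ∷_) (allVecs n k)) (allFin n)

block : ∀ {n k} → Vec (Fin n) k → Fin n → Subset k
block f i = tabulate (λ x → if ⌊ lookup f x ≟ᶠ i ⌋ then inside else outside)

decomposition : ∀ {n k} → Vec (Fin n) k → List (Subset k)
decomposition {n} f = map (block f) (allFin n)

χHG : (k : ℕ) → Hypergraph k → ℕ → ℕ
χHG k H n = sum (map (λ f → product (map ζ (ΔHG (decomposition f) H))) (allVecs n k))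

χSHG : (k : ℕ) → Hypergraph k → ℕ → ℕ
χSHG k H n = sum (map (λ f → product (map ζ (ΔSHG (decomposition f) H))) (allVecs n k))

-- ζ only asks whether some edge has at least two vertices, so it is blind to
-- multiplicities and to the extra empty edge by which the two contractions
-- differ. Hence, along any decomposition, the iterated coproducts in SHG and HG
-- have the same large edges factor by factor, and ζ⊗…⊗ζ agrees on them.

module Submission where

open import Defs
open import Data.Nat using (ℕ; _≤_; _≤?_; _*_; z≤n)
open import Data.Nat.Properties using (≤-trans)
open import Data.Nat.ListAction using (sum; product)
open import Data.Fin.Subset using (Subset; _∩_; ∁; ∣_∣; ⊥)
open import Data.Fin.Subset.Properties using (_⊆?_; p⊆q⇒∣p∣≤∣q∣; p∩q⊆p; ∣⊥∣≡0)
open import Data.List using (List; []; _∷_; filter; map)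
open import Data.List.Properties using (map-cong)
open import Data.List.Membership.Propositional using (_∈_; find; lose)
open import Data.List.Membership.Propositional.Properties
  using (∈-filter⁺; ∈-filter⁻; ∈-map∘filter⁺; ∈-map∘filter⁻; ∈-deduplicate⁺; ∈-deduplicate⁻)
open import Data.List.Relation.Unary.Any using (Any; here; there)
open import Data.List.Relation.Unary.All using (All; []; _∷_; all?)
open import Data.List.Relation.Unary.All.Properties using (¬All⇒Any¬; Any¬⇒¬All)
open import Data.List.Relation.Unary.Unique.Propositional using (Unique)
open import Data.Product using (_,_; _×_)
import Data.Product as Product
open import Data.Sum using (_⊎_; inj₁; inj₂)
open import Function using (_∘′_)
open import Relation.Nullary using (¬_; ¬?; yes; no; contradiction)
open import Relation.Binary.PropositionalEquality using (_≡_; refl; sym; trans; cong; cong₂)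

Small : ∀ {k} → Subset k → Set
Small e = ∣ e ∣ ≤ 1

Large : ∀ {k} → Subset k → Set
Large e = ¬ Small e

_⊆ᴸ_ : ∀ {k} → Hypergraph k → Hypergraph k → Set
L ⊆ᴸ M = ∀ {e} → Large e → e ∈ L → e ∈ M

_≈ᴸ_ : ∀ {k} → Hypergraph k → Hypergraph k → Set
L ≈ᴸ M = L ⊆ᴸ M × M ⊆ᴸ L

≈ᴸ-refl : ∀ {k} {L : Hypergraph k} → L ≈ᴸ L
≈ᴸ-refl = (λ _ e∈L → e∈L) , (λ _ e∈L → e∈L)

≈ᴸ-trans : ∀ {k} {L M N : Hypergraph k} → L ≈ᴸ M → M ≈ᴸ N → L ≈ᴸ N
≈ᴸ-trans (L⊆M , M⊆L) (M⊆N , N⊆M) =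
  (λ large → M⊆N large ∘′ L⊆M large) , (λ large → M⊆L large ∘′ N⊆M large)

⊆ᴸ-any-large : ∀ {k} {L M : Hypergraph k} → L ⊆ᴸ M → Any Large L → Any Large M
⊆ᴸ-any-large L⊆M anyLarge with find anyLarge
... | e , e∈L , large = lose (L⊆M large e∈L) large

discrete⊎any-large : ∀ {k} (L : Hypergraph k) → All Small L ⊎ Any Large L
discrete⊎any-large L with all? (λ e → ∣ e ∣ ≤? 1) L
... | yes discrete = inj₁ discrete
... | no ¬discrete = inj₂ (¬All⇒Any¬ (λ e → ∣ e ∣ ≤? 1) L ¬discrete)

ζ-discrete : ∀ {k} {L : Hypergraph k} → All Small L → ζ L ≡ 1
ζ-discrete [] = refl
ζ-discrete {L = e ∷ L} (small ∷ discrete) with ∣ e ∣ ≤? 1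
... | yes _ = ζ-discrete discrete
... | no large = contradiction small large

ζ-any-large : ∀ {k} {L : Hypergraph k} → Any Large L → ζ L ≡ 0
ζ-any-large {L = e ∷ L} anyLarge with ∣ e ∣ ≤? 1 | anyLarge
... | yes small | here large = contradiction small large
... | yes _     | there anyLarge′ = ζ-any-large anyLarge′
... | no _      | _ = refl

ζ-cong : ∀ {k} {L M : Hypergraph k} → L ≈ᴸ M → ζ L ≡ ζ M
ζ-cong {L = L} {M} (L⊆M , M⊆L) with discrete⊎any-large L | discrete⊎any-large M
... | inj₁ discreteL | inj₁ discreteM = trans (ζ-discrete discreteL) (sym (ζ-discrete discreteM))
... | inj₂ largeL    | _ = trans (ζ-any-large largeL) (sym (ζ-any-large (⊆ᴸ-any-large L⊆M largeL)))
... | inj₁ discreteL | inj₂ largeM = contradiction discreteL (Any¬⇒¬All (⊆ᴸ-any-large M⊆L largeM))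

restrict-⊆ᴸ : ∀ {k} (S : Subset k) {L M : Hypergraph k} → L ⊆ᴸ M → restrictHG S L ⊆ᴸ restrictHG S M
restrict-⊆ᴸ S {L} L⊆M large e∈SL with ∈-filter⁻ (_⊆? S) {xs = L} e∈SL
... | e∈L , e⊆S = ∈-filter⁺ (_⊆? S) (L⊆M large e∈L) e⊆S

-- Contracting only shrinks edges, so a large edge of L/S comes from a large edge of L.
contractHG-⊆ᴸ : ∀ {k} (S : Subset k) {L M : Hypergraph k} → L ⊆ᴸ M → contractHG S L ⊆ᴸ contractHG S M
contractHG-⊆ᴸ S {L} L⊆M large e∈L/S
  with ∈-map∘filter⁻ (_∩ ∁ S) (λ e → ¬? (e ⊆? S)) {xs = L} e∈L/S
... | x , x∈L , refl , x⊈S = ∈-map∘filter⁺ (_∩ ∁ S) (λ e → ¬? (e ⊆? S)) (x , L⊆M largeX x∈L , refl , x⊈S)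
  where
  largeX : Large x
  largeX small = large (≤-trans (p⊆q⇒∣p∣≤∣q∣ (p∩q⊆p x (∁ S))) small)

restrict-≈ᴸ : ∀ {k} (S : Subset k) {L M : Hypergraph k} → L ≈ᴸ M → restrictHG S L ≈ᴸ restrictHG S M
restrict-≈ᴸ S = Product.map (restrict-⊆ᴸ S) (restrict-⊆ᴸ S)

contractHG-≈ᴸ : ∀ {k} (S : Subset k) {L M : Hypergraph k} → L ≈ᴸ M → contractHG S L ≈ᴸ contractHG S M
contractHG-≈ᴸ S = Product.map (contractHG-⊆ᴸ S) (contractHG-⊆ᴸ S)

⊥-small : ∀ {k} → Small (⊥ {k})
⊥-small {k} rewrite ∣⊥∣≡0 k = z≤n

contractSHG≈ᴸcontractHG : ∀ {k} (S : Subset k) (L : Hypergraph k) → contractSHG S L ≈ᴸ contractHG S L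
contractSHG≈ᴸcontractHG {k} S L = SHG⊆ᴸHG , HG⊆ᴸSHG
  where
  SHG⊆ᴸHG : contractSHG S L ⊆ᴸ contractHG S L
  SHG⊆ᴸHG large e∈dedup with ∈-deduplicate⁻ _≟ˢ_ (⊥ ∷ contractHG S L) e∈dedup
  ... | here refl = contradiction (⊥-small {k}) large
  ... | there e∈L/S = e∈L/S

  HG⊆ᴸSHG : contractHG S L ⊆ᴸ contractSHG S L
  HG⊆ᴸSHG _ e∈L/S = ∈-deduplicate⁺ _≟ˢ_ (there e∈L/S)

ζ-ΔSHG≡ζ-ΔHG : ∀ {k} (Ss : List (Subset k)) {L M : Hypergraph k} → L ≈ᴸ M →
  product (map ζ (ΔSHG Ss L)) ≡ product (map ζ (ΔHG Ss M))
ζ-ΔSHG≡ζ-ΔHG []       _   = refl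
ζ-ΔSHG≡ζ-ΔHG (S ∷ Ss) {L} L≈M = cong₂ _*_
  (ζ-cong (restrict-≈ᴸ S L≈M))
  (ζ-ΔSHG≡ζ-ΔHG Ss (≈ᴸ-trans (contractSHG≈ᴸcontractHG S L) (contractHG-≈ᴸ S L≈M)))

mainTheorem6 : (k : ℕ) (H : Hypergraph k) → Unique H →
    (n : ℕ) → χSHG k H n ≡ χHG k H n
mainTheorem6 k H _ n =
  cong sum (map-cong (λ f → ζ-ΔSHG≡ζ-ΔHG (decomposition f) ≈ᴸ-refl) (allVecs n k))
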